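{- Let $G$ be a $3$-regular graph on $n$ vertices, every vertex colored distinctly, and $f:E(G)\to\{0,1\}$. If $f$ has even parity then $Ex(X_f(G))\ge \frac{1}{54}Ex(G)$. If $f$ has odd parity and $Ex(G)>987/n$, then also $Ex(X_f(G))\ge\frac{1}{54}Ex(G)$.
   Context: CFI construction. Let $G$ be a $3$-regular graph in which every vertex $v$ has a distinct color $c(v)$; fix for each vertex $v$ an ordering $u_1,u_2,u_3$ of its neighbors. For $f:E(G)\to\{0,1\}$ the graph $X_f(G)$ has, for each $v\in V(G)$ with neighbors $u_1,u_2,u_3$, four middle vertices $v_{b_1,b_2,b_3}$ ($b_1\oplus b_2\oplus b_3=0$) and six edge vertices $(v,u_i)_b$ ($i\in\{1,2,3\}$, $b\in\{0,1\}$). Edges: $v_{b_1,b_2,b_3}$ is adjacent to $(v,u_i)_{b_i}$ for $i=1,2,3$; and for each edge $\{u,v\}\in E(G)$ and $b\in\{0,1\}$, $(v,u)_b$ is adjacent to $(u,v)_{b\oplus f(\{u,v\})}$; no other edges. (Colors are irrelevant for expansion.) The parity of $f$ is the parity of $|\{e:f(e)=1\}|$. Expansion: for a graph $H$ and $S\subseteq V(H)$, $Ex(S)=|E(S,V(H)\setminus S)|/\min\{|S|,|V(H)\setminus S|\}$, with $E(S,T)$ the set of edges between $S$ and $T$; $Ex(H)=\min Ex(S)$ over nonempty proper subsets $S$. -}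

module Defs where

open import Data.Bool using (Bool; true; false; _∧_; _∨_; not; _xor_; if_then_else_)
open import Data.Nat as ℕ using (ℕ; zero; suc; _<ᵇ_; _≡ᵇ_; _*_; _+_; _∸_)
open import Data.Fin using (Fin; zero; suc; toℕ; remQuot)
open import Data.Fin.Properties using (_≟_)
open import Data.Integer using (+_)
open import Data.Rational using (ℚ; 0ℚ; _/_; _⊓_)
open import Data.List using (List; []; _∷_; map; foldr; concatMap; allFin)
open import Data.Bool.ListAction using (any)
open import Data.Vec using (Vec; []; _∷_; lookup)
open import Data.Product using (_×_; _,_; ∃)
open import Relation.Binary.PropositionalEquality using (_≡_; _≢_)
open import Relation.Nullary.Decidable using (⌊_⌋)
open import Function.Definitions using (Injective)

AdjRel : ℕ → Set
AdjRel N = Fin N → Fin N → Bool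

count : {A : Set} → (A → Bool) → List A → ℕ
count p []       = 0
count p (x ∷ xs) = if p x then suc (count p xs) else count p xs

pairs : (N : ℕ) → List (Fin N × Fin N)
pairs N = concatMap (λ u → map (λ v → (u , v)) (allFin N)) (allFin N)

Subset : ℕ → Set
Subset N = Vec Bool N

allSubsets : (N : ℕ) → List (Subset N)
allSubsets zero    = [] ∷ []
allSubsets (suc N) = concatMap (λ s → (true ∷ s) ∷ (false ∷ s) ∷ []) (allSubsets N)

size : {N : ℕ} → Subset N → ℕ
size S = count (lookup S) (allFin _)

-- |E(S, V ∖ S)| : each edge {u,v} with u ∈ S, v ∉ S is counted once,
-- via the ordered pair (u , v).
cut : {N : ℕ} → AdjRel N → Subset N → ℕ
cut {N} adj S =
  count (λ { (u , v) → lookup S u ∧ not (lookup S v) ∧ adj u v }) (pairs N)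

-- a / d as a rational (d = 0 never occurs in the uses below)
_÷ℕ_ : ℕ → ℕ → ℚ
a ÷ℕ zero  = 0ℚ
a ÷ℕ suc d = (+ a) / suc d

ExS : {N : ℕ} → AdjRel N → Subset N → ℚ
ExS {N} adj S = cut adj S ÷ℕ ℕ._⊓_ (size S) (N ∸ size S)

isNonemptyProper : {N : ℕ} → Subset N → Bool
isNonemptyProper {N} S = (0 <ᵇ size S) ∧ (size S <ᵇ N)

filterᵇ : {A : Set} → (A → Bool) → List A → List A
filterᵇ p []       = []
filterᵇ p (x ∷ xs) = if p x then x ∷ filterᵇ p xs else filterᵇ p xs

minList : List ℚ → ℚ
minList []       = 0ℚ      -- only for graphs with ≤ 1 vertex (no proper nonempty S)
minList (x ∷ xs) = foldr _⊓_ x xs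

Ex : {N : ℕ} → AdjRel N → ℚ
Ex {N} adj = minList (map (ExS adj) (filterᵇ isNonemptyProper (allSubsets N)))

-- 3-regular graphs with an ordering of the neighbours of each vertex:
-- nb v i is the (i+1)-th neighbour u_{i+1} of v.

record Cubic (n : ℕ) (nb : Fin n → Fin 3 → Fin n) : Set where
  field
    loopless  : ∀ v i → nb v i ≢ v
    distinct  : ∀ v → Injective _≡_ _≡_ (nb v)
    symmetric : ∀ v i → ∃ λ j → nb (nb v i) j ≡ v

adjG : {n : ℕ} → (Fin n → Fin 3 → Fin n) → AdjRel n
adjG nb u v = any (λ i → ⌊ nb u i ≟ v ⌋) (allFin 3)

-- number of edges {u,v} of G with f({u,v}) = 1 (f given as a symmetric
-- function on pairs of vertices; only its values on edges matter)
weight : {n : ℕ} → (Fin n → Fin 3 → Fin n) → (Fin n → Fin n → Bool) → ℕ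
weight {n} nb f =
  count (λ { (u , v) → (toℕ u <ᵇ toℕ v) ∧ adjG nb u v ∧ f u v }) (pairs n)

EvenParity OddParity : {n : ℕ} → (Fin n → Fin 3 → Fin n) → (Fin n → Fin n → Bool) → Set
EvenParity nb f = weight nb f ℕ.% 2 ≡ 0
OddParity  nb f = weight nb f ℕ.% 2 ≡ 1

-- Each vertex v of G contributes 10 vertices:
--   mid b₁ b₂  : the middle vertex v_{b₁,b₂,b₁⊕b₂}  (4 of them)
--   edv i b    : the edge vertex (v, u_{i+1})_b      (6 of them)

data Local : Set where
  mid : Bool → Bool → Local
  edv : Fin 3 → Bool → Local

decode : Fin 10 → Local
decode zero = mid false false
decode (suc zero) = mid false true
decode (suc (suc zero)) = mid true false
decode (suc (suc (suc zero))) = mid true true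
decode (suc (suc (suc (suc zero)))) = edv zero false
decode (suc (suc (suc (suc (suc zero))))) = edv zero true
decode (suc (suc (suc (suc (suc (suc zero)))))) = edv (suc zero) false
decode (suc (suc (suc (suc (suc (suc (suc zero))))))) = edv (suc zero) true
decode (suc (suc (suc (suc (suc (suc (suc (suc zero)))))))) = edv (suc (suc zero)) false
decode (suc (suc (suc (suc (suc (suc (suc (suc (suc zero)))))))))  = edv (suc (suc zero)) true

bitOf : Bool → Bool → Fin 3 → Bool
bitOf b₁ b₂ zero             = b₁
bitOf b₁ b₂ (suc zero)       = b₂
bitOf b₁ b₂ (suc (suc zero)) = b₁ xor b₂

eqB : Bool → Bool → Bool
eqB a b = not (a xor b)

adjLocal : {n : ℕ} → (Fin n → Fin 3 → Fin n) → (Fin n → Fin n → Bool) →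
           Fin n → Local → Fin n → Local → Bool
adjLocal nb f v (mid b₁ b₂) w (edv i b) = ⌊ v ≟ w ⌋ ∧ eqB b (bitOf b₁ b₂ i)
adjLocal nb f v (edv i b) w (mid b₁ b₂) = ⌊ v ≟ w ⌋ ∧ eqB b (bitOf b₁ b₂ i)
adjLocal nb f v (edv i b) w (edv j b') =
  ⌊ nb v i ≟ w ⌋ ∧ ⌊ nb w j ≟ v ⌋ ∧ eqB b' (b xor f v w)
adjLocal nb f v (mid _ _) w (mid _ _) = false

-- X_f(G) on vertex set Fin (n * 10), vertex index ↦ (v , local index)
adjX : {n : ℕ} → (Fin n → Fin 3 → Fin n) → (Fin n → Fin n → Bool) → AdjRel (n * 10)
adjX {n} nb f x y with remQuot {n} 10 x | remQuot {n} 10 y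
... | (v , k) | (w , l) = adjLocal nb f v (decode k) w (decode l)

module Submission where

-- Expansion of CFI graphs: Ex(X_f(G)) ≥ Ex(G)/54 for every cubic graph G and every f : E(G) → {0,1}.
-- The bound holds for all f.
--
-- Fix a nonempty proper set S of vertices of X_f(G). Every vertex v of G owns a gadget of ten
-- vertices (four middle and six edge vertices); v lies in the majority set A when at least five of
-- them lie in S. The deviation of a gadget is the number of its vertices on its minority side; an
-- edge vertex is misplaced when it lies on the side opposite to its gadget's majority.
--   * Gadget lemma (exhaustive check of all 2^10 patterns): per gadget,
--     5·misplaced + 3·deviation ≤ 54·(cut edges inside the gadget), and each side of S within the
--     gadget is at most 10·[the gadget is on that side] + deviation.
--   * Crossing lemma: an edge of G leaving A yields, for each of its two bits, an external cut edge
--     of X_f(G) or a misplaced edge vertex, so 2·|E_G(A, Ā)| ≤ external cut + misplaced.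
--   * Summing: 10·|E_G(A, Ā)| + 3·deviation ≤ 54·|E_X(S, S̄)| and
--     min(|S|, |S̄|) ≤ 10·min(|A|, |Ā|) + deviation.
--   * Since Ex(G) ≤ 3 (a single vertex) and Ex(G)·min(|A|, |Ā|) ≤ |E_G(A, Ā)|, rational arithmetic
--     yields Ex(S) ≥ Ex(G)/54, and taking the minimum over S proves the theorem.

module FiniteSums where

  open import Data.Bool using (Bool; true; false; not; _∧_; _∨_)
  open import Data.Nat using (ℕ; zero; suc; _+_; _*_; _∸_; _≤_; z≤n)
  open import Data.Nat.Properties
    using (+-*-semiring; +-mono-≤; +-assoc; m≤m+n; m≤n+m; ≤-trans; ≤-reflexive; *-identityˡ; *-identityʳ; +-identityʳ; m+n∸m≡n; ≤-refl)
  open import Data.Fin using (Fin; zero; suc; _↑ˡ_; _↑ʳ_; combine)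
  open import Data.Fin.Properties using (_≟_)
  open import Data.List using (List; []; _∷_; map; concat; _++_; tabulate)
  open import Data.List.Properties using (map-tabulate)
  open import Data.Product using (_×_; _,_)
  open import Relation.Binary.PropositionalEquality
  open import Relation.Nullary.Decidable using (⌊_⌋; yes; no)
  open import Relation.Nullary.Negation using (contradiction)
  open import Function using (_∘_)
  open import Defs using (count; pairs)
  open import Algebra.Properties.Semiring.Sum +-*-semiring public
    using (sum; sum-syntax; sum-cong-≗; ∑-distrib-+; ∑-comm; *-distribˡ-sum; sum-replicate-zero)

  ⟦_⟧ : Bool → ℕ
  ⟦ true ⟧  = 1
  ⟦ false ⟧ = 0

  ⟦∧⟧ : ∀ a b → ⟦ a ∧ b ⟧ ≡ ⟦ a ⟧ * ⟦ b ⟧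
  ⟦∧⟧ true  b = sym (+-identityʳ ⟦ b ⟧)
  ⟦∧⟧ false b = refl

  ⟦∧⟧-≤ˡ : ∀ a b → ⟦ a ∧ b ⟧ ≤ ⟦ a ⟧
  ⟦∧⟧-≤ˡ true  b = ⟦≤1⟧ b
    where
    ⟦≤1⟧ : ∀ b → ⟦ b ⟧ ≤ 1
    ⟦≤1⟧ true  = ≤-refl
    ⟦≤1⟧ false = z≤n
  ⟦∧⟧-≤ˡ false b = z≤n

  ⟦∨⟧ : ∀ a b → ⟦ a ∨ b ⟧ ≤ ⟦ a ⟧ + ⟦ b ⟧
  ⟦∨⟧ true  b = m≤m+n 1 ⟦ b ⟧
  ⟦∨⟧ false b = ≤-refl

  ⟦b⟧+⟦¬b⟧ : ∀ b → ⟦ b ⟧ + ⟦ not b ⟧ ≡ 1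
  ⟦b⟧+⟦¬b⟧ true  = refl
  ⟦b⟧+⟦¬b⟧ false = refl

  ∑-mono : ∀ n {f g : Fin n → ℕ} → (∀ x → f x ≤ g x) → ∑[ x < n ] f x ≤ ∑[ x < n ] g x
  ∑-mono zero    le = z≤n
  ∑-mono (suc n) le = +-mono-≤ (le zero) (∑-mono n (le ∘ suc))

  ∑-term : ∀ n (f : Fin n → ℕ) x → f x ≤ ∑[ y < n ] f y
  ∑-term (suc n) f zero    = m≤m+n _ _
  ∑-term (suc n) f (suc x) = ≤-trans (∑-term n (f ∘ suc) x) (m≤n+m _ _)

  ∑-const : ∀ n c → ∑[ _ < n ] c ≡ n * c
  ∑-const zero    c = refl
  ∑-const (suc n) c = cong (c +_) (∑-const n c)

  ≟-true : ∀ {m} {x y : Fin m} → x ≡ y → ⌊ x ≟ y ⌋ ≡ true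
  ≟-true {x = x} {y} eq with x ≟ y
  ... | yes _   = refl
  ... | no  x≢y = contradiction eq x≢y

  ∑-select : ∀ n (v : Fin n) (g : Fin n → ℕ) → ∑[ w < n ] (⟦ ⌊ v ≟ w ⌋ ⟧ * g w) ≡ g v
  ∑-select (suc n) zero    g = trans (cong₂ _+_ (*-identityˡ (g zero)) (sum-replicate-zero n)) (+-identityʳ _)
  ∑-select (suc n) (suc v) g = trans (sum-cong-≗ shift) (∑-select n v (g ∘ suc))
    where
    shift : ∀ w → ⟦ ⌊ suc v ≟ suc w ⌋ ⟧ * g (suc w) ≡ ⟦ ⌊ v ≟ w ⌋ ⟧ * g (suc w)
    shift w with v ≟ w
    ... | yes _ = refl
    ... | no  _ = refl

  ∑-select-block : ∀ m k (v : Fin m) (F : Fin m → Fin k → ℕ) →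
                   ∑[ w < m ] ∑[ l < k ] (⟦ ⌊ v ≟ w ⌋ ⟧ * F w l) ≡ ∑[ l < k ] F v l
  ∑-select-block m k v F =
    trans (sum-cong-≗ (λ w → sym (*-distribˡ-sum ⟦ ⌊ v ≟ w ⌋ ⟧ (F w)))) (∑-select m v (λ w → ∑[ l < k ] F w l))

  ∑-select₂ : ∀ m k (v : Fin m) (i : Fin k) (F : Fin m → Fin k → ℕ) →
              ∑[ w < m ] ∑[ j < k ] (⟦ ⌊ v ≟ w ⌋ ⟧ * (⟦ ⌊ i ≟ j ⌋ ⟧ * F w j)) ≡ F v i
  ∑-select₂ m k v i F = trans (∑-select-block m k v (λ w j → ⟦ ⌊ i ≟ j ⌋ ⟧ * F w j)) (∑-select k i (F v))

  ∑-comm₂ : ∀ a b c d (F : Fin a → Fin b → Fin c → Fin d → ℕ) →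
            ∑[ x < a ] ∑[ y < b ] ∑[ z < c ] ∑[ t < d ] F x y z t ≡ ∑[ z < c ] ∑[ t < d ] ∑[ x < a ] ∑[ y < b ] F x y z t
  ∑-comm₂ a b c d F = begin
      ∑[ x < a ] ∑[ y < b ] ∑[ z < c ] ∑[ t < d ] F x y z t
    ≡⟨ sum-cong-≗ (λ x → ∑-comm (λ y z → ∑[ t < d ] F x y z t)) ⟩
      ∑[ x < a ] ∑[ z < c ] ∑[ y < b ] ∑[ t < d ] F x y z t
    ≡⟨ sum-cong-≗ (λ x → sum-cong-≗ (λ z → ∑-comm (λ y t → F x y z t))) ⟩
      ∑[ x < a ] ∑[ z < c ] ∑[ t < d ] ∑[ y < b ] F x y z t
    ≡⟨ ∑-comm (λ x z → ∑[ t < d ] ∑[ y < b ] F x y z t) ⟩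
      ∑[ z < c ] ∑[ x < a ] ∑[ t < d ] ∑[ y < b ] F x y z t
    ≡⟨ sum-cong-≗ (λ z → ∑-comm (λ x t → ∑[ y < b ] F x y z t)) ⟩
      ∑[ z < c ] ∑[ t < d ] ∑[ x < a ] ∑[ y < b ] F x y z t
    ∎
    where open ≡-Reasoning

  ∑-+-≤ : ∀ n (f g : Fin n → ℕ) {h : Fin n → ℕ} → (∀ x → f x + g x ≤ h x) → ∑[ x < n ] f x + ∑[ x < n ] g x ≤ ∑[ x < n ] h x
  ∑-+-≤ n f g le = ≤-trans (≤-reflexive (sym (∑-distrib-+ f g))) (∑-mono n le)

  ∑-complement : ∀ n (p : Fin n → Bool) → n ∸ ∑[ x < n ] ⟦ p x ⟧ ≡ ∑[ x < n ] ⟦ not (p x) ⟧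
  ∑-complement n p = begin
      n ∸ P
    ≡⟨ cong (_∸ P) total ⟩
      (P + ∑[ x < n ] ⟦ not (p x) ⟧) ∸ P
    ≡⟨ m+n∸m≡n P _ ⟩
      ∑[ x < n ] ⟦ not (p x) ⟧
    ∎
    where
    open ≡-Reasoning
    P = ∑[ x < n ] ⟦ p x ⟧
    total : n ≡ P + ∑[ x < n ] ⟦ not (p x) ⟧
    total = sym (trans (sym (∑-distrib-+ (λ x → ⟦ p x ⟧) (λ x → ⟦ not (p x) ⟧)))
                       (trans (sum-cong-≗ (λ x → ⟦b⟧+⟦¬b⟧ (p x))) (trans (∑-const n 1) (*-identityʳ n))))

  ∑-split : ∀ m k (g : Fin (m + k) → ℕ) →
            ∑[ x < m + k ] g x ≡ ∑[ x < m ] g (x ↑ˡ k) + ∑[ y < k ] g (m ↑ʳ y)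
  ∑-split zero    k g = refl
  ∑-split (suc m) k g = trans (cong (g zero +_) (∑-split m k (g ∘ suc))) (sym (+-assoc (g zero) _ _))

  ∑-combine : ∀ n k (g : Fin (n * k) → ℕ) → ∑[ x < n * k ] g x ≡ ∑[ v < n ] ∑[ j < k ] g (combine v j)
  ∑-combine zero    k g = refl
  ∑-combine (suc n) k g = trans (∑-split k (n * k) g) (cong (∑[ j < k ] g (j ↑ˡ (n * k)) +_) (∑-combine n k (λ y → g (k ↑ʳ y))))

  count-++ : ∀ {A : Set} (p : A → Bool) xs ys → count p (xs ++ ys) ≡ count p xs + count p ys
  count-++ p []       ys = refl
  count-++ p (x ∷ xs) ys with p x
  ... | true  = cong suc (count-++ p xs ys)
  ... | false = count-++ p xs ys

  count-tabulate : ∀ {A : Set} n (p : A → Bool) (f : Fin n → A) →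
                   count p (tabulate f) ≡ ∑[ x < n ] ⟦ p (f x) ⟧
  count-tabulate zero    p f = refl
  count-tabulate (suc n) p f with p (f zero)
  ... | true  = cong suc (count-tabulate n p (f ∘ suc))
  ... | false = count-tabulate n p (f ∘ suc)

  count-concat : ∀ {A : Set} n (p : A → Bool) (f : Fin n → List A) →
                 count p (concat (tabulate f)) ≡ ∑[ x < n ] count p (f x)
  count-concat zero    p f = refl
  count-concat (suc n) p f = trans (count-++ p (f zero) _) (cong (count p (f zero) +_) (count-concat n p (f ∘ suc)))

  count-pairs : ∀ N (p : Fin N × Fin N → Bool) → count p (pairs N) ≡ ∑[ u < N ] ∑[ v < N ] ⟦ p (u , v) ⟧
  count-pairs N p = begin
      count p (pairs N)
    ≡⟨ cong (count p ∘ concat) (map-tabulate (λ u → u) row) ⟩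
      count p (concat (tabulate row))
    ≡⟨ count-concat N p row ⟩
      ∑[ u < N ] count p (row u)
    ≡⟨ sum-cong-≗ (λ u → trans (cong (count p) (map-tabulate (λ v → v) (u ,_))) (count-tabulate N p (u ,_))) ⟩
      ∑[ u < N ] ∑[ v < N ] ⟦ p (u , v) ⟧
    ∎
    where
    open ≡-Reasoning
    row : Fin N → List (Fin N × Fin N)
    row u = map (u ,_) (tabulate (λ v → v))


module Expansion where

  open import Data.Bool using (Bool; true; false; _∧_; not)
  open import Data.Bool.Properties using (T-≡; T-∧)
  open import Data.Fin using (Fin)
  open import Data.Fin.Properties using (_≟_)
  open import Relation.Nullary.Decidable using (⌊_⌋)
  open import Data.Nat using (ℕ; zero; suc; _∸_; _⊓_; _≤_; _<_; z<s; _<ᵇ_)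
  open import Data.Nat.Properties using (<ᵇ⇒<; <⇒<ᵇ; ⊓-glb; m⊓n≤m; m⊓n≤n; m<n⇒0<n∸m; m∸n≢0⇒n<m; n>0⇒n≢0; <-≤-trans; *-identityʳ)
  open import Data.Integer using (+_)
  open import Data.Rational using (_/_) renaming (_⊓_ to _⊓ℚ_; _≤_ to _≤ℚ_)
  open import Data.Rational.Properties using (≤-refl; ≤-trans; p⊓q≤p; p⊓q≤q) renaming (⊓-glb to ⊓ℚ-glb)
  open import Data.Vec using ([]; _∷_; lookup; tabulate)
  open import Data.Vec.Properties using (lookup∘tabulate)
  open import Data.List using ([]; _∷_; map; foldr)
  open import Data.List.Relation.Unary.Any as Any using (here; there)
  open import Data.List.Membership.Propositional using (_∈_)
  open import Data.List.Membership.Propositional.Properties using (∈-map⁺; ∈-map⁻; ∈-concatMap⁺)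
  open import Data.Product using (∃; _×_; _,_)
  open import Relation.Binary.PropositionalEquality
  open import Function using (Equivalence)
  open import Defs
  open FiniteSums

  size-∑ : ∀ {N} (S : Subset N) → size S ≡ ∑[ x < N ] ⟦ lookup S x ⟧
  size-∑ {N} S = count-tabulate N (lookup S) (λ x → x)

  size-tabulate : ∀ {N} (A : Fin N → Bool) → size (tabulate A) ≡ ∑[ x < N ] ⟦ A x ⟧
  size-tabulate {N} A = trans (size-∑ (tabulate A)) (sum-cong-≗ (λ x → cong ⟦_⟧ (lookup∘tabulate A x)))

  cut-∑ : ∀ {N} (adj : AdjRel N) (S : Subset N) →
          cut adj S ≡ ∑[ u < N ] ∑[ w < N ] ⟦ lookup S u ∧ not (lookup S w) ∧ adj u w ⟧
  cut-∑ {N} adj S = count-pairs N _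

  cut-tabulate : ∀ {N} (adj : AdjRel N) (A : Fin N → Bool) →
                 cut adj (tabulate A) ≡ ∑[ u < N ] ∑[ w < N ] ⟦ A u ∧ not (A w) ∧ adj u w ⟧
  cut-tabulate {N} adj A = trans (cut-∑ adj (tabulate A)) (sum-cong-≗ (λ u → sum-cong-≗ (λ w →
    cong₂ (λ a b → ⟦ a ∧ not b ∧ adj u w ⟧) (lookup∘tabulate A u) (lookup∘tabulate A w))))

  minSide : ∀ {N} → Subset N → ℕ
  minSide {N} S = size S ⊓ (N ∸ size S)

  ExS-fraction : ∀ {N} (adj : AdjRel N) (S : Subset N) m → minSide S ≡ suc m → ExS adj S ≡ (+ cut adj S) / suc m
  ExS-fraction adj S m eq rewrite eq = refl

  nonemptyProper⁻ : ∀ {N} (S : Subset N) → isNonemptyProper S ≡ true → 0 < size S × size S < N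
  nonemptyProper⁻ {N} S e with Equivalence.to (T-∧ {0 <ᵇ size S}) (Equivalence.from T-≡ e)
  ... | nonempty , proper = <ᵇ⇒< 0 (size S) nonempty , <ᵇ⇒< (size S) N proper

  nonemptyProper⁺ : ∀ {N} (S : Subset N) → 0 < size S → size S < N → isNonemptyProper S ≡ true
  nonemptyProper⁺ S nonempty proper = Equivalence.to T-≡ (Equivalence.from T-∧ (<⇒<ᵇ nonempty , <⇒<ᵇ proper))

  nonemptyProper⇒minSide : ∀ {N} (S : Subset N) → isNonemptyProper S ≡ true → ∃ λ m → minSide S ≡ suc m
  nonemptyProper⇒minSide S e with nonemptyProper⁻ S e
  ... | nonempty , proper = positive⇒suc (⊓-glb nonempty (m<n⇒0<n∸m proper))
    where
    positive⇒suc : ∀ {k} → 0 < k → ∃ λ m → k ≡ suc m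
    positive⇒suc {suc k} _ = k , refl

  minSide⇒nonemptyProper : ∀ {N} (S : Subset N) m → minSide S ≡ suc m → isNonemptyProper S ≡ true
  minSide⇒nonemptyProper {N} S m eq = nonemptyProper⁺ S (<-≤-trans z<s (subst (_≤ size S) eq (m⊓n≤m _ _)))
    (m∸n≢0⇒n<m {N} {size S} (n>0⇒n≢0 (<-≤-trans z<s (subst (_≤ N ∸ size S) eq (m⊓n≤n _ _)))))

  minList-≤ : ∀ l x → x ∈ l → minList l ≤ℚ x
  minList-≤ (a ∷ ys) = foldr-≤ a ys
    where
    foldr-≤ : ∀ a ys x → x ∈ a ∷ ys → foldr _⊓ℚ_ a ys ≤ℚ x
    foldr-≤ a []       x (here refl)         = ≤-refl
    foldr-≤ a (y ∷ ys) x (here refl)         = ≤-trans (p⊓q≤q y _) (foldr-≤ a ys x (here refl))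
    foldr-≤ a (y ∷ ys) x (there (here refl)) = p⊓q≤p x _
    foldr-≤ a (y ∷ ys) x (there (there m))   = ≤-trans (p⊓q≤q y _) (foldr-≤ a ys x (there m))

  minList-glb : ∀ {r} l {x₀} → x₀ ∈ l → (∀ x → x ∈ l → r ≤ℚ x) → r ≤ℚ minList l
  minList-glb (a ∷ ys) _ = foldr-glb a ys
    where
    foldr-glb : ∀ {r} a ys → (∀ x → x ∈ a ∷ ys → r ≤ℚ x) → r ≤ℚ foldr _⊓ℚ_ a ys
    foldr-glb a []       h = h a (here refl)
    foldr-glb a (y ∷ ys) h = ⊓ℚ-glb (h y (there (here refl))) (foldr-glb a ys (λ x m → h x (skip m)))
      where
      skip : ∀ {x} → x ∈ a ∷ ys → x ∈ a ∷ y ∷ ys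
      skip (here e)  = here e
      skip (there m) = there (there m)

  ∈-allSubsets : ∀ N (S : Subset N) → S ∈ allSubsets N
  ∈-allSubsets zero    []          = here refl
  ∈-allSubsets (suc N) (true ∷ S)  = ∈-concatMap⁺ _ (Any.map (λ { refl → here refl }) (∈-allSubsets N S))
  ∈-allSubsets (suc N) (false ∷ S) = ∈-concatMap⁺ _ (Any.map (λ { refl → there (here refl) }) (∈-allSubsets N S))

  ∈-filter⁺ : ∀ {A : Set} (p : A → Bool) {x} xs → x ∈ xs → p x ≡ true → x ∈ filterᵇ p xs
  ∈-filter⁺ p (y ∷ xs) (here refl) e rewrite e = here refl
  ∈-filter⁺ p (y ∷ xs) (there m)   e with p y
  ... | true  = there (∈-filter⁺ p xs m e)
  ... | false = ∈-filter⁺ p xs m e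

  ∈-filter⁻ : ∀ {A : Set} (p : A → Bool) {x} xs → x ∈ filterᵇ p xs → p x ≡ true
  ∈-filter⁻ p (y ∷ xs) m with p y in e
  ∈-filter⁻ p (y ∷ xs) (here refl) | true = e
  ∈-filter⁻ p (y ∷ xs) (there m)   | true = ∈-filter⁻ p xs m
  ... | false = ∈-filter⁻ p xs m

  Ex-≤ : ∀ {N} (adj : AdjRel N) S → isNonemptyProper S ≡ true → Ex adj ≤ℚ ExS adj S
  Ex-≤ {N} adj S e = minList-≤ _ _ (∈-map⁺ (ExS adj) (∈-filter⁺ isNonemptyProper (allSubsets N) (∈-allSubsets N S) e))

  Ex-glb : ∀ {N} (adj : AdjRel N) {r} S₀ → isNonemptyProper S₀ ≡ true →
           (∀ S → isNonemptyProper S ≡ true → r ≤ℚ ExS adj S) → r ≤ℚ Ex adj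
  Ex-glb {N} adj S₀ e₀ bound =
    minList-glb _ (∈-map⁺ (ExS adj) (∈-filter⁺ isNonemptyProper (allSubsets N) (∈-allSubsets N S₀) e₀)) below
    where
    below : ∀ x → x ∈ map (ExS adj) (filterᵇ isNonemptyProper (allSubsets N)) → _ ≤ℚ x
    below x m with ∈-map⁻ (ExS adj) m
    ... | S , mS , refl = bound S (∈-filter⁻ isNonemptyProper (allSubsets N) mS)

  singleton : ∀ {N} → Fin N → Subset N
  singleton v = tabulate (λ w → ⌊ v ≟ w ⌋)

  size-singleton : ∀ {N} (v : Fin N) → size (singleton v) ≡ 1
  size-singleton {N} v = trans (size-tabulate (λ w → ⌊ v ≟ w ⌋))
                               (trans (sum-cong-≗ (λ w → sym (*-identityʳ ⟦ ⌊ v ≟ w ⌋ ⟧))) (∑-select N v (λ _ → 1)))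

  singleton-nonemptyProper : ∀ {N} (v : Fin (suc (suc N))) → isNonemptyProper (singleton v) ≡ true
  singleton-nonemptyProper v rewrite size-singleton v = refl

  Ex-≤-singleton : ∀ {N} (adj : AdjRel (suc (suc N))) (v : Fin (suc (suc N))) → Ex adj ≤ℚ (+ cut adj (singleton v)) / 1
  Ex-≤-singleton {N} adj v = subst (Ex adj ≤ℚ_) (ExS-fraction adj (singleton v) 0 minSide≡1) (Ex-≤ adj (singleton v) (singleton-nonemptyProper v))
    where
    minSide≡1 : minSide (singleton v) ≡ 1
    minSide≡1 rewrite size-singleton v = refl


module Gadget where

  open import Data.Bool using (Bool; true; false; _∧_; not; _xor_; T)
  open import Data.Bool.Properties using (T-∧)
  open import Data.Nat using (ℕ; zero; suc; _+_; _*_; _≤_; _≤ᵇ_)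
  open import Data.Nat.Properties using (≤ᵇ⇒≤; ≤-trans; ≤-reflexive; m≤m+n; +-comm; *-distribˡ-+)
  open import Data.Nat.Tactic.RingSolver using (solve-∀)
  open import Data.Fin using (Fin; zero; suc; #_)
  open import Data.Vec using (Vec; []; _∷_; lookup; tabulate)
  open import Data.Product using (_×_; proj₁; proj₂)
  open import Relation.Binary.PropositionalEquality
  open import Function using (Equivalence)
  open import Defs
  open FiniteSums

  internalAdj : Local → Local → Bool
  internalAdj (mid b₁ b₂) (edv i b) = eqB b (bitOf b₁ b₂ i)
  internalAdj (edv i b) (mid b₁ b₂) = eqB b (bitOf b₁ b₂ i)
  internalAdj _ _ = false

  edgeIndex : Fin 3 → Bool → Fin 10
  edgeIndex zero             false = # 4
  edgeIndex zero             true  = # 5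
  edgeIndex (suc zero)       false = # 6
  edgeIndex (suc zero)       true  = # 7
  edgeIndex (suc (suc zero)) false = # 8
  edgeIndex (suc (suc zero)) true  = # 9

  decode-edgeIndex : ∀ i b → decode (edgeIndex i b) ≡ edv i b
  decode-edgeIndex zero             false = refl
  decode-edgeIndex zero             true  = refl
  decode-edgeIndex (suc zero)       false = refl
  decode-edgeIndex (suc zero)       true  = refl
  decode-edgeIndex (suc (suc zero)) false = refl
  decode-edgeIndex (suc (suc zero)) true  = refl

  ∑₂ : (Bool → ℕ) → ℕ
  ∑₂ h = h false + h true

  ∑-edgeVertices : ∀ (h : Fin 10 → ℕ) → ∑[ i < 3 ] ∑₂ (λ b → h (edgeIndex i b)) ≤ ∑[ k < 10 ] h k
  ∑-edgeVertices h = ≤-trans (m≤m+n _ _) (≤-reflexive (regroup (h (# 0)) (h (# 1)) (h (# 2)) (h (# 3))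
                       (h (# 4)) (h (# 5)) (h (# 6)) (h (# 7)) (h (# 8)) (h (# 9))))
    where
    regroup : ∀ a₀ a₁ a₂ a₃ a₄ a₅ a₆ a₇ a₈ a₉ →
              ((a₄ + a₅) + ((a₆ + a₇) + ((a₈ + a₉) + 0))) + (a₀ + a₁ + a₂ + a₃)
              ≡ a₀ + (a₁ + (a₂ + (a₃ + (a₄ + (a₅ + (a₆ + (a₇ + (a₈ + (a₉ + 0)))))))))
    regroup = solve-∀

  ∑₂-xor : ∀ (h : Bool → ℕ) c → ∑₂ (λ b → h (b xor c)) ≡ ∑₂ h
  ∑₂-xor h false = refl
  ∑₂-xor h true  = +-comm (h true) (h false)

  ∑-edgeVertices-factor : ∀ (a : Bool) (h : Fin 3 → Bool → Bool) →
                          ∑[ i < 3 ] ∑₂ (λ b → ⟦ a ∧ h i b ⟧) ≡ ⟦ a ⟧ * ∑[ i < 3 ] ∑₂ (λ b → ⟦ h i b ⟧)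
  ∑-edgeVertices-factor a h = begin
      ∑[ i < 3 ] ∑₂ (λ b → ⟦ a ∧ h i b ⟧)
    ≡⟨ sum-cong-≗ (λ i → cong₂ _+_ (⟦∧⟧ a (h i false)) (⟦∧⟧ a (h i true))) ⟩
      ∑[ i < 3 ] (⟦ a ⟧ * ⟦ h i false ⟧ + ⟦ a ⟧ * ⟦ h i true ⟧)
    ≡⟨ sum-cong-≗ (λ i → sym (*-distribˡ-+ ⟦ a ⟧ ⟦ h i false ⟧ ⟦ h i true ⟧)) ⟩
      ∑[ i < 3 ] (⟦ a ⟧ * ∑₂ (λ b → ⟦ h i b ⟧))
    ≡⟨ sym (*-distribˡ-sum ⟦ a ⟧ (λ i → ∑₂ (λ b → ⟦ h i b ⟧))) ⟩
      ⟦ a ⟧ * ∑[ i < 3 ] ∑₂ (λ b → ⟦ h i b ⟧)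
    ∎
    where open ≡-Reasoning

  -- Below, g : Fin 10 → Bool records which vertices of one gadget lie in S.

  internalCut : (Fin 10 → Bool) → ℕ
  internalCut g = ∑[ k < 10 ] ∑[ l < 10 ] ⟦ g k ∧ not (g l) ∧ internalAdj (decode k) (decode l) ⟧

  inside outside edgesInside edgesOutside : (Fin 10 → Bool) → ℕ
  inside g       = ∑[ k < 10 ] ⟦ g k ⟧
  outside g      = ∑[ k < 10 ] ⟦ not (g k) ⟧
  edgesInside g  = ∑[ i < 3 ] ∑₂ (λ b → ⟦ g (edgeIndex i b) ⟧)
  edgesOutside g = ∑[ i < 3 ] ∑₂ (λ b → ⟦ not (g (edgeIndex i b)) ⟧)

  majority : (Fin 10 → Bool) → Bool
  majority g = 5 ≤ᵇ inside g

  -- "if t then x else y", written arithmetically so that it can be summed.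
  choose : Bool → ℕ → ℕ → ℕ
  choose t x y = ⟦ t ⟧ * x + ⟦ not t ⟧ * y

  misplacedEdges deviation : (Fin 10 → Bool) → ℕ
  misplacedEdges g = choose (majority g) (edgesOutside g) (edgesInside g)
  deviation g      = choose (majority g) (outside g) (inside g)

  cutTest insideTest outsideTest gadgetBounds : (Fin 10 → Bool) → Bool
  cutTest g     = 5 * misplacedEdges g + 3 * deviation g ≤ᵇ 54 * internalCut g
  insideTest g  = inside g ≤ᵇ 10 * ⟦ majority g ⟧ + deviation g
  outsideTest g = outside g ≤ᵇ 10 * ⟦ not (majority g) ⟧ + deviation g
  gadgetBounds g = cutTest g ∧ insideTest g ∧ outsideTest g

  everyVec : ∀ k → (Vec Bool k → Bool) → Bool
  everyVec zero    p = p []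
  everyVec (suc k) p = everyVec k (λ v → p (true ∷ v)) ∧ everyVec k (λ v → p (false ∷ v))

  everyVec-sound : ∀ k p → T (everyVec k p) → ∀ v → T (p v)
  everyVec-sound zero    p t [] = t
  everyVec-sound (suc k) p t (true ∷ v)  = everyVec-sound k _ (proj₁ (Equivalence.to (T-∧ {everyVec k _}) t)) v
  everyVec-sound (suc k) p t (false ∷ v) = everyVec-sound k _ (proj₂ (Equivalence.to (T-∧ {everyVec k _}) t)) v

  -- The local inequalities hold for all 2^10 patterns, checked by evaluation (every index of g is a
  -- literal after unfolding, so lookup (tabulate g) computes to g).
  gadgetBounds-hold : ∀ g → T (gadgetBounds g)
  gadgetBounds-hold g = everyVec-sound 10 (λ v → gadgetBounds (lookup v)) _ (tabulate g)

  sizeTests-hold : ∀ g → T (insideTest g) × T (outsideTest g)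
  sizeTests-hold g = Equivalence.to (T-∧ {insideTest g}) (proj₂ (Equivalence.to (T-∧ {cutTest g}) (gadgetBounds-hold g)))

  gadget-cut : ∀ g → 5 * misplacedEdges g + 3 * deviation g ≤ 54 * internalCut g
  gadget-cut g = ≤ᵇ⇒≤ _ _ (proj₁ (Equivalence.to (T-∧ {cutTest g}) (gadgetBounds-hold g)))

  gadget-inside : ∀ g → inside g ≤ 10 * ⟦ majority g ⟧ + deviation g
  gadget-inside g = ≤ᵇ⇒≤ _ _ (proj₁ (sizeTests-hold g))

  gadget-outside : ∀ g → outside g ≤ 10 * ⟦ not (majority g) ⟧ + deviation g
  gadget-outside g = ≤ᵇ⇒≤ _ _ (proj₂ (sizeTests-hold g))


module CubicGraph where

  open import Data.Bool using (Bool; false; _∧_; not)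
  open import Data.Bool.Properties using (∧-assoc)
  open import Data.Nat using (ℕ; _*_; _≤_; z≤n)
  open import Data.Nat.Properties hiding (_≟_)
  open import Data.Fin using (Fin; zero; suc)
  open import Data.Fin.Properties using (_≟_)
  open import Data.Vec using (tabulate)
  open import Data.Product using (proj₁; proj₂)
  open import Relation.Binary.PropositionalEquality
  open import Relation.Nullary.Decidable using (⌊_⌋; yes; no)
  open import Defs
  open FiniteSums
  open Expansion

  module _ {n : ℕ} (nb : Fin n → Fin 3 → Fin n) where

    adjG-≤-slots : ∀ u w → ⟦ adjG nb u w ⟧ ≤ ∑[ i < 3 ] ⟦ ⌊ nb u i ≟ w ⌋ ⟧
    adjG-≤-slots u w =
      ≤-trans (⟦∨⟧ (slot zero) _) (+-monoʳ-≤ ⟦ slot zero ⟧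
     (≤-trans (⟦∨⟧ (slot (suc zero)) _) (+-monoʳ-≤ ⟦ slot (suc zero) ⟧
              (⟦∨⟧ (slot (suc (suc zero))) false))))
      where
      slot : Fin 3 → Bool
      slot i = ⌊ nb u i ≟ w ⌋

    cut-≤-slots : ∀ (A : Fin n → Bool) → cut (adjG nb) (tabulate A) ≤ ∑[ v < n ] ∑[ i < 3 ] ⟦ A v ∧ not (A (nb v i)) ⟧
    cut-≤-slots A = begin
        cut (adjG nb) (tabulate A)
      ≡⟨ cut-tabulate (adjG nb) A ⟩
        ∑[ u < n ] ∑[ w < n ] ⟦ A u ∧ not (A w) ∧ adjG nb u w ⟧
      ≡⟨ sum-cong-≗ (λ u → sum-cong-≗ (λ w → separate u w)) ⟩
        ∑[ u < n ] ∑[ w < n ] (leaves u w * ⟦ adjG nb u w ⟧)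
      ≤⟨ ∑-mono n (λ u → ∑-mono n (λ w → *-monoʳ-≤ (leaves u w) (adjG-≤-slots u w))) ⟩
        ∑[ u < n ] ∑[ w < n ] (leaves u w * ∑[ i < 3 ] ⟦ ⌊ nb u i ≟ w ⌋ ⟧)
      ≡⟨ sum-cong-≗ (λ u → sum-cong-≗ (λ w → trans (*-distribˡ-sum (leaves u w) (λ i → ⟦ ⌊ nb u i ≟ w ⌋ ⟧)) (sum-cong-≗ (λ i → *-comm (leaves u w) ⟦ ⌊ nb u i ≟ w ⌋ ⟧)))) ⟩
        ∑[ u < n ] ∑[ w < n ] ∑[ i < 3 ] (⟦ ⌊ nb u i ≟ w ⌋ ⟧ * leaves u w)
      ≡⟨ sum-cong-≗ (λ u → ∑-comm (λ w i → ⟦ ⌊ nb u i ≟ w ⌋ ⟧ * leaves u w)) ⟩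
        ∑[ u < n ] ∑[ i < 3 ] ∑[ w < n ] (⟦ ⌊ nb u i ≟ w ⌋ ⟧ * leaves u w)
      ≡⟨ sum-cong-≗ (λ u → sum-cong-≗ (λ i → ∑-select n (nb u i) (leaves u))) ⟩
        ∑[ v < n ] ∑[ i < 3 ] ⟦ A v ∧ not (A (nb v i)) ⟧
      ∎
      where
      open ≤-Reasoning
      leaves : Fin n → Fin n → ℕ
      leaves u w = ⟦ A u ∧ not (A w) ⟧
      separate : ∀ u w → ⟦ A u ∧ not (A w) ∧ adjG nb u w ⟧ ≡ leaves u w * ⟦ adjG nb u w ⟧
      separate u w = trans (cong ⟦_⟧ (sym (∧-assoc (A u) (not (A w)) _))) (⟦∧⟧ (A u ∧ not (A w)) _)

    cut-singleton : ∀ v → cut (adjG nb) (singleton v) ≤ 3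
    cut-singleton v = begin
        cut (adjG nb) (singleton v)
      ≤⟨ cut-≤-slots isV ⟩
        ∑[ u < n ] ∑[ i < 3 ] ⟦ isV u ∧ not (isV (nb u i)) ⟧
      ≤⟨ ∑-mono n (λ u → ∑-mono 3 (λ i → ⟦∧⟧-≤ˡ (isV u) (not (isV (nb u i))))) ⟩
        ∑[ u < n ] ∑[ i < 3 ] ⟦ isV u ⟧
      ≡⟨ sum-cong-≗ (λ u → trans (∑-const 3 ⟦ isV u ⟧) (*-comm 3 ⟦ isV u ⟧)) ⟩
        ∑[ u < n ] (⟦ isV u ⟧ * 3)
      ≡⟨ ∑-select n v (λ _ → 3) ⟩
        3
      ∎
      where
      open ≤-Reasoning
      isV : Fin n → Bool
      isV u = ⌊ v ≟ u ⌋

  module _ {n : ℕ} {nb : Fin n → Fin 3 → Fin n} (cubic : Cubic n nb) where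

    open Cubic cubic

    back : Fin n → Fin 3 → Fin 3
    back v i = proj₁ (symmetric v i)

    nb-back : ∀ v i → nb (nb v i) (back v i) ≡ v
    nb-back v i = proj₂ (symmetric v i)

    back-back : ∀ v i → back (nb v i) (back v i) ≡ i
    back-back v i = distinct v (trans (cong (λ z → nb z (back (nb v i) (back v i))) (sym (nb-back v i)))
                                      (nb-back (nb v i) (back v i)))

    reverse-slot : ∀ v i w j → ⟦ ⌊ nb v i ≟ w ⌋ ⟧ * ⟦ ⌊ back v i ≟ j ⌋ ⟧ ≤ ⟦ ⌊ nb w j ≟ v ⌋ ⟧ * ⟦ ⌊ back w j ≟ i ⌋ ⟧
    reverse-slot v i w j with nb v i ≟ w | back v i ≟ j
    ... | no _     | _        = z≤n
    ... | yes _    | no _     = z≤n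
    ... | yes refl | yes refl rewrite ≟-true (nb-back v i)
                                    | ≟-true (back-back v i) = ≤-refl

    -- Reversing slots permutes the 3n slots, so it does not increase a sum over slots.
    ∑-reverse-slots : ∀ (F : Fin n → Fin 3 → ℕ) → ∑[ v < n ] ∑[ i < 3 ] F (nb v i) (back v i) ≤ ∑[ w < n ] ∑[ j < 3 ] F w j
    ∑-reverse-slots F = begin
        ∑[ v < n ] ∑[ i < 3 ] F (nb v i) (back v i)
      ≡⟨ sum-cong-≗ (λ v → sum-cong-≗ (λ i → sym (∑-select₂ n 3 (nb v i) (back v i) F))) ⟩
        ∑[ v < n ] ∑[ i < 3 ] ∑[ w < n ] ∑[ j < 3 ] (⟦ ⌊ nb v i ≟ w ⌋ ⟧ * (⟦ ⌊ back v i ≟ j ⌋ ⟧ * F w j))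
      ≤⟨ ∑-mono n (λ v → ∑-mono 3 (λ i → ∑-mono n (λ w → ∑-mono 3 (λ j → reversed v i w j)))) ⟩
        ∑[ v < n ] ∑[ i < 3 ] ∑[ w < n ] ∑[ j < 3 ] (⟦ ⌊ nb w j ≟ v ⌋ ⟧ * (⟦ ⌊ back w j ≟ i ⌋ ⟧ * F w j))
      ≡⟨ ∑-comm₂ n 3 n 3 (λ v i w j → ⟦ ⌊ nb w j ≟ v ⌋ ⟧ * (⟦ ⌊ back w j ≟ i ⌋ ⟧ * F w j)) ⟩
        ∑[ w < n ] ∑[ j < 3 ] ∑[ v < n ] ∑[ i < 3 ] (⟦ ⌊ nb w j ≟ v ⌋ ⟧ * (⟦ ⌊ back w j ≟ i ⌋ ⟧ * F w j))
      ≡⟨ sum-cong-≗ (λ w → sum-cong-≗ (λ j → ∑-select₂ n 3 (nb w j) (back w j) (λ _ _ → F w j))) ⟩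
        ∑[ w < n ] ∑[ j < 3 ] F w j
      ∎
      where
      open ≤-Reasoning
      reversed : ∀ v i w j → ⟦ ⌊ nb v i ≟ w ⌋ ⟧ * (⟦ ⌊ back v i ≟ j ⌋ ⟧ * F w j) ≤ ⟦ ⌊ nb w j ≟ v ⌋ ⟧ * (⟦ ⌊ back w j ≟ i ⌋ ⟧ * F w j)
      reversed v i w j = begin
          ⟦ ⌊ nb v i ≟ w ⌋ ⟧ * (⟦ ⌊ back v i ≟ j ⌋ ⟧ * F w j)
        ≡⟨ sym (*-assoc ⟦ ⌊ nb v i ≟ w ⌋ ⟧ _ _) ⟩
          ⟦ ⌊ nb v i ≟ w ⌋ ⟧ * ⟦ ⌊ back v i ≟ j ⌋ ⟧ * F w j
        ≤⟨ *-monoˡ-≤ (F w j) (reverse-slot v i w j) ⟩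
          ⟦ ⌊ nb w j ≟ v ⌋ ⟧ * ⟦ ⌊ back w j ≟ i ⌋ ⟧ * F w j
        ≡⟨ *-assoc ⟦ ⌊ nb w j ≟ v ⌋ ⟧ _ _ ⟩
          ⟦ ⌊ nb w j ≟ v ⌋ ⟧ * (⟦ ⌊ back w j ≟ i ⌋ ⟧ * F w j)
        ∎


module CutCounting where

  open import Data.Bool using (Bool; true; false; _∧_; not; _xor_)
  open import Data.Bool.Properties using (∧-identityʳ)
  open import Data.Nat using (ℕ; _+_; _*_; _∸_; _⊓_; _≤_; z≤n; s≤s)
  open import Data.Nat.Properties hiding (_≟_)
  open import Data.Fin using (Fin; combine)
  open import Data.Fin.Properties using (_≟_; remQuot-combine)
  open import Data.Vec using (lookup; tabulate)
  open import Data.Product using (proj₁; proj₂)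
  open import Relation.Binary.PropositionalEquality
  open import Relation.Nullary.Decidable using (⌊_⌋)
  open import Data.Nat.Tactic.RingSolver using (solve-∀)
  open import Defs
  open FiniteSums
  open Expansion
  open Gadget
  open CubicGraph

  externalAdj : ∀ {n} → (Fin n → Fin 3 → Fin n) → (Fin n → Fin n → Bool) → Fin n → Local → Fin n → Local → Bool
  externalAdj nb f v (edv i b) w (edv j b') = adjLocal nb f v (edv i b) w (edv j b')
  externalAdj nb f v _         w _          = false

  onlyInternal : ∀ x y c e → ⟦ c ⟧ * ⟦ x ∧ not y ∧ e ⟧ + ⟦ x ∧ not y ∧ false ⟧ ≤ ⟦ x ∧ not y ∧ (c ∧ e) ⟧
  onlyInternal true  false true  true  = ≤-refl
  onlyInternal true  false true  false = ≤-refl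
  onlyInternal true  false false e     = z≤n
  onlyInternal true  true  c     e     = ≤-reflexive (trans (+-identityʳ (⟦ c ⟧ * 0)) (*-zeroʳ ⟦ c ⟧))
  onlyInternal false y     c     e     = ≤-reflexive (trans (+-identityʳ (⟦ c ⟧ * 0)) (*-zeroʳ ⟦ c ⟧))

  onlyExternal : ∀ x y c e → ⟦ c ⟧ * ⟦ x ∧ not y ∧ false ⟧ + ⟦ x ∧ not y ∧ e ⟧ ≤ ⟦ x ∧ not y ∧ e ⟧
  onlyExternal x y c e = ≤-reflexive (cong (_+ ⟦ x ∧ not y ∧ e ⟧) (trans (cong (⟦ c ⟧ *_) (noEdge x y)) (*-zeroʳ ⟦ c ⟧)))
    where
    noEdge : ∀ x y → ⟦ x ∧ not y ∧ false ⟧ ≡ 0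
    noEdge true  true  = refl
    noEdge true  false = refl
    noEdge false y     = refl

  -- Every edge of X_f(G) is internal to a gadget or external, never both, so the two kinds of
  -- cut edges add up.
  internal+external≤adj : ∀ {n} (nb : Fin n → Fin 3 → Fin n) f x y v p w q →
    ⟦ ⌊ v ≟ w ⌋ ⟧ * ⟦ x ∧ not y ∧ internalAdj p q ⟧ + ⟦ x ∧ not y ∧ externalAdj nb f v p w q ⟧
      ≤ ⟦ x ∧ not y ∧ adjLocal nb f v p w q ⟧
  internal+external≤adj nb f x y v (mid _ _) w (mid _ _) = onlyExternal x y ⌊ v ≟ w ⌋ false
  internal+external≤adj nb f x y v (mid _ _) w (edv _ _) = onlyInternal x y ⌊ v ≟ w ⌋ _
  internal+external≤adj nb f x y v (edv _ _) w (mid _ _) = onlyInternal x y ⌊ v ≟ w ⌋ _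
  internal+external≤adj nb f x y v (edv _ _) w (edv _ _) = onlyExternal x y ⌊ v ≟ w ⌋ _

  -- An edge of G from a vertex in A to one outside A (a, a'), with edge vertices x and y at its two ends:
  -- either x → y is cut, or x lies outside S although its gadget is in A, or y lies in S although its
  -- gadget is not.
  crossing : ∀ a a' x y → ⟦ a ∧ not a' ⟧ ≤ ⟦ x ∧ not y ⟧ + ⟦ a ∧ not x ⟧ + ⟦ not a' ∧ y ⟧
  crossing false a'    x     y     = z≤n
  crossing true  true  x     y     = z≤n
  crossing true  false true  true  = s≤s z≤n
  crossing true  false true  false = s≤s z≤n
  crossing true  false false y     = s≤s z≤n

  eqB-refl : ∀ b → eqB b b ≡ true
  eqB-refl true  = refl
  eqB-refl false = refl

  chain-bounds : ∀ {c X M D I C} → c + c ≤ X + M → 5 * M + 3 * D ≤ 54 * I → I + X ≤ C → 10 * c + 3 * D ≤ 54 * C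
  chain-bounds {c} {X} {M} {D} {I} {C} twice local split = begin
      10 * c + 3 * D
    ≡⟨ cong (_+ 3 * D) (double c) ⟩
      5 * (c + c) + 3 * D
    ≤⟨ +-monoˡ-≤ (3 * D) (*-monoʳ-≤ 5 twice) ⟩
      5 * (X + M) + 3 * D
    ≡⟨ regroup X M D ⟩
      5 * X + (5 * M + 3 * D)
    ≤⟨ +-mono-≤ (*-monoˡ-≤ X {5} {54} (s≤s (s≤s (s≤s (s≤s (s≤s z≤n)))))) local ⟩
      54 * X + 54 * I
    ≡⟨ factor X I ⟩
      54 * (I + X)
    ≤⟨ *-monoʳ-≤ 54 split ⟩
      54 * C
    ∎
    where
    open ≤-Reasoning
    double : ∀ a → 10 * a ≡ 5 * (a + a)
    double = solve-∀
    regroup : ∀ a b d → 5 * (a + b) + 3 * d ≡ 5 * a + (5 * b + 3 * d)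
    regroup = solve-∀
    factor : ∀ a b → 54 * a + 54 * b ≡ 54 * (b + a)
    factor = solve-∀

  module _ {n : ℕ} {nb : Fin n → Fin 3 → Fin n} (cubic : Cubic n nb) (f : Fin n → Fin n → Bool)
           (S : Subset (n * 10)) where

    inGadget : Fin n → Fin 10 → Bool
    inGadget v k = lookup S (combine v k)

    cutTerm internalTerm externalTerm : Fin n → Fin 10 → Fin n → Fin 10 → ℕ
    cutTerm      v k w l = ⟦ inGadget v k ∧ not (inGadget w l) ∧ adjLocal nb f v (decode k) w (decode l) ⟧
    internalTerm v k w l = ⟦ inGadget v k ∧ not (inGadget w l) ∧ internalAdj (decode k) (decode l) ⟧
    externalTerm v k w l = ⟦ inGadget v k ∧ not (inGadget w l) ∧ externalAdj nb f v (decode k) w (decode l) ⟧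

    internalCuts externalCut : ℕ
    internalCuts = ∑[ v < n ] internalCut (inGadget v)
    externalCut  = ∑[ v < n ] ∑[ k < 10 ] ∑[ w < n ] ∑[ l < 10 ] externalTerm v k w l

    cutX-∑ : cut (adjX nb f) S ≡ ∑[ v < n ] ∑[ k < 10 ] ∑[ w < n ] ∑[ l < 10 ] cutTerm v k w l
    cutX-∑ = begin
        cut (adjX nb f) S
      ≡⟨ cut-∑ (adjX nb f) S ⟩
        ∑[ x < n * 10 ] ∑[ y < n * 10 ] ⟦ lookup S x ∧ not (lookup S y) ∧ adjX nb f x y ⟧
      ≡⟨ ∑-combine n 10 (λ x → ∑[ y < n * 10 ] ⟦ lookup S x ∧ not (lookup S y) ∧ adjX nb f x y ⟧) ⟩
        ∑[ v < n ] ∑[ k < 10 ] ∑[ y < n * 10 ] ⟦ inGadget v k ∧ not (lookup S y) ∧ adjX nb f (combine v k) y ⟧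
      ≡⟨ sum-cong-≗ (λ v → sum-cong-≗ (λ k → ∑-combine n 10 (λ y → ⟦ inGadget v k ∧ not (lookup S y) ∧ adjX nb f (combine v k) y ⟧))) ⟩
        ∑[ v < n ] ∑[ k < 10 ] ∑[ w < n ] ∑[ l < 10 ]
          ⟦ inGadget v k ∧ not (inGadget w l) ∧ adjX nb f (combine v k) (combine w l) ⟧
      ≡⟨ sum-cong-≗ (λ v → sum-cong-≗ (λ k → sum-cong-≗ (λ w → sum-cong-≗ (λ l →
           cong (λ e → ⟦ inGadget v k ∧ not (inGadget w l) ∧ e ⟧) (adjX-combine v k w l))))) ⟩
        ∑[ v < n ] ∑[ k < 10 ] ∑[ w < n ] ∑[ l < 10 ] cutTerm v k w l
      ∎
      where
      open ≡-Reasoning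
      adjX-combine : ∀ v k w l → adjX nb f (combine v k) (combine w l) ≡ adjLocal nb f v (decode k) w (decode l)
      adjX-combine v k w l = cong₂ (λ x y → adjLocal nb f (proj₁ x) (decode (proj₂ x)) (proj₁ y) (decode (proj₂ y)))
                                   (remQuot-combine v k) (remQuot-combine w l)

    internal+external≤cutX : internalCuts + externalCut ≤ cut (adjX nb f) S
    internal+external≤cutX = begin
        internalCuts + externalCut
      ≤⟨ ∑-+-≤ n (λ v → internalCut (inGadget v)) (λ v → ∑[ k < 10 ] ∑[ w < n ] ∑[ l < 10 ] externalTerm v k w l) (λ v →
           ∑-+-≤ 10 (λ k → ∑[ l < 10 ] internalTerm v k v l) (λ k → ∑[ w < n ] ∑[ l < 10 ] externalTerm v k w l) (atVertex v)) ⟩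
        ∑[ v < n ] ∑[ k < 10 ] ∑[ w < n ] ∑[ l < 10 ] cutTerm v k w l
      ≡⟨ sym cutX-∑ ⟩
        cut (adjX nb f) S
      ∎
      where
      open ≤-Reasoning
      atVertex : ∀ v k → ∑[ l < 10 ] internalTerm v k v l + ∑[ w < n ] ∑[ l < 10 ] externalTerm v k w l
                       ≤ ∑[ w < n ] ∑[ l < 10 ] cutTerm v k w l
      atVertex v k = begin
          ∑[ l < 10 ] internalTerm v k v l + ∑[ w < n ] ∑[ l < 10 ] externalTerm v k w l
        ≡⟨ cong (_+ ∑[ w < n ] ∑[ l < 10 ] externalTerm v k w l) (sym (∑-select-block n 10 v (internalTerm v k))) ⟩
          ∑[ w < n ] ∑[ l < 10 ] (⟦ ⌊ v ≟ w ⌋ ⟧ * internalTerm v k w l) + ∑[ w < n ] ∑[ l < 10 ] externalTerm v k w l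
        ≤⟨ ∑-+-≤ n (λ w → ∑[ l < 10 ] (⟦ ⌊ v ≟ w ⌋ ⟧ * internalTerm v k w l)) (λ w → ∑[ l < 10 ] externalTerm v k w l) (λ w →
           ∑-+-≤ 10 (λ l → ⟦ ⌊ v ≟ w ⌋ ⟧ * internalTerm v k w l) (externalTerm v k w) (λ l →
             internal+external≤adj nb f (inGadget v k) (inGadget w l) v (decode k) w (decode l))) ⟩
          ∑[ w < n ] ∑[ l < 10 ] cutTerm v k w l
        ∎

    majoritySet : Fin n → Bool
    majoritySet v = majority (inGadget v)

    cutG : ℕ
    cutG = cut (adjG nb) (tabulate majoritySet)

    misplaced deviations : ℕ
    misplaced  = ∑[ v < n ] misplacedEdges (inGadget v)
    deviations = ∑[ v < n ] deviation (inGadget v)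

    ∑slots : (Fin n → Fin 3 → Bool → ℕ) → ℕ
    ∑slots h = ∑[ v < n ] ∑[ i < 3 ] ∑₂ (h v i)

    ∑slots-+ : ∀ h₁ h₂ → ∑slots (λ v i b → h₁ v i b + h₂ v i b) ≡ ∑slots h₁ + ∑slots h₂
    ∑slots-+ h₁ h₂ = trans (sum-cong-≗ (λ v → trans (sum-cong-≗ (λ i → interchange (h₁ v i false) (h₂ v i false) (h₁ v i true) (h₂ v i true)))
                                                    (∑-distrib-+ (λ i → ∑₂ (h₁ v i)) (λ i → ∑₂ (h₂ v i)))))
                           (∑-distrib-+ (λ v → ∑[ i < 3 ] ∑₂ (h₁ v i)) (λ v → ∑[ i < 3 ] ∑₂ (h₂ v i)))
      where
      interchange : ∀ a b c d → (a + b) + (c + d) ≡ (a + c) + (b + d)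
      interchange = solve-∀

    -- The two edge vertices joined along slot i of v for bit b: the near one in the gadget of v,
    -- the far one in the gadget of its neighbour.
    farBit : Fin n → Fin 3 → Bool → Bool
    farBit v i b = b xor f v (nb v i)

    near far : Fin n → Fin 3 → Bool → Bool
    near v i b = inGadget v (edgeIndex i b)
    far  v i b = inGadget (nb v i) (edgeIndex (back cubic v i) (farBit v i b))

    cutPair misplacedNear misplacedFar : Fin n → Fin 3 → Bool → ℕ
    cutPair       v i b = ⟦ near v i b ∧ not (far v i b) ⟧
    misplacedNear v i b = ⟦ majoritySet v ∧ not (near v i b) ⟧
    misplacedFar  v i b = ⟦ not (majoritySet (nb v i)) ∧ far v i b ⟧

    cutG-twice : cutG + cutG ≤ ∑slots cutPair + ∑slots misplacedNear + ∑slots misplacedFar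
    cutG-twice = begin
        cutG + cutG
      ≤⟨ +-mono-≤ (cut-≤-slots nb majoritySet) (cut-≤-slots nb majoritySet) ⟩
        ∑[ v < n ] ∑[ i < 3 ] leaves v i + ∑[ v < n ] ∑[ i < 3 ] leaves v i
      ≡⟨ sym (∑-distrib-+ (λ v → ∑[ i < 3 ] leaves v i) (λ v → ∑[ i < 3 ] leaves v i)) ⟩
        ∑[ v < n ] (∑[ i < 3 ] leaves v i + ∑[ i < 3 ] leaves v i)
      ≡⟨ sum-cong-≗ (λ v → sym (∑-distrib-+ (leaves v) (leaves v))) ⟩
        ∑slots (λ v i b → leaves v i)
      ≤⟨ ∑-mono n (λ v → ∑-mono 3 (λ i → +-mono-≤ (atSlot v i false) (atSlot v i true))) ⟩
        ∑slots (λ v i b → cutPair v i b + misplacedNear v i b + misplacedFar v i b)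
      ≡⟨ ∑slots-+ (λ v i b → cutPair v i b + misplacedNear v i b) misplacedFar ⟩
        ∑slots (λ v i b → cutPair v i b + misplacedNear v i b) + ∑slots misplacedFar
      ≡⟨ cong (_+ ∑slots misplacedFar) (∑slots-+ cutPair misplacedNear) ⟩
        ∑slots cutPair + ∑slots misplacedNear + ∑slots misplacedFar
      ∎
      where
      open ≤-Reasoning
      leaves : Fin n → Fin 3 → ℕ
      leaves v i = ⟦ majoritySet v ∧ not (majoritySet (nb v i)) ⟧
      atSlot : ∀ v i b → leaves v i ≤ cutPair v i b + misplacedNear v i b + misplacedFar v i b
      atSlot v i b = crossing (majoritySet v) (majoritySet (nb v i)) (near v i b) (far v i b)

    cutPairs≤externalCut : ∑slots cutPair ≤ externalCut
    cutPairs≤externalCut = ∑-mono n (λ v →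
      ≤-trans (∑-mono 3 (λ i → +-mono-≤ (single v i false) (single v i true)))
              (∑-edgeVertices (λ k → ∑[ w < n ] ∑[ l < 10 ] externalTerm v k w l)))
      where
      partner : ∀ v i b → externalTerm v (edgeIndex i b) (nb v i) (edgeIndex (back cubic v i) (farBit v i b)) ≡ cutPair v i b
      partner v i b
        rewrite decode-edgeIndex i b | decode-edgeIndex (back cubic v i) (farBit v i b)
              | ≟-true (refl {x = nb v i}) | ≟-true (nb-back cubic v i) | eqB-refl (farBit v i b)
              = cong ⟦_⟧ (cong (near v i b ∧_) (∧-identityʳ _))
      single : ∀ v i b → cutPair v i b ≤ ∑[ w < n ] ∑[ l < 10 ] externalTerm v (edgeIndex i b) w l
      single v i b = ≤-trans (≤-reflexive (sym (partner v i b)))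
                     (≤-trans (∑-term 10 (externalTerm v (edgeIndex i b) (nb v i)) (edgeIndex (back cubic v i) (farBit v i b)))
                              (∑-term n (λ w → ∑[ l < 10 ] externalTerm v (edgeIndex i b) w l) (nb v i)))

    misplacedNear≡ : ∑slots misplacedNear ≡ ∑[ v < n ] (⟦ majoritySet v ⟧ * edgesOutside (inGadget v))
    misplacedNear≡ = sum-cong-≗ (λ v → ∑-edgeVertices-factor (majoritySet v) (λ i b → not (near v i b)))

    misplacedFar≤ : ∑slots misplacedFar ≤ ∑[ v < n ] (⟦ not (majoritySet v) ⟧ * edgesInside (inGadget v))
    misplacedFar≤ = begin
        ∑slots misplacedFar
      ≡⟨ sum-cong-≗ (λ v → sum-cong-≗ (λ i →
           ∑₂-xor (λ b' → ⟦ not (majoritySet (nb v i)) ∧ inGadget (nb v i) (edgeIndex (back cubic v i) b') ⟧) (f v (nb v i)))) ⟩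
        ∑[ v < n ] ∑[ i < 3 ] wrongSide (nb v i) (back cubic v i)
      ≤⟨ ∑-reverse-slots cubic wrongSide ⟩
        ∑[ w < n ] ∑[ j < 3 ] wrongSide w j
      ≡⟨ sum-cong-≗ (λ w → ∑-edgeVertices-factor (not (majoritySet w)) (λ j b → inGadget w (edgeIndex j b))) ⟩
        ∑[ v < n ] (⟦ not (majoritySet v) ⟧ * edgesInside (inGadget v))
      ∎
      where
      open ≤-Reasoning
      wrongSide : Fin n → Fin 3 → ℕ
      wrongSide w j = ∑₂ (λ b → ⟦ not (majoritySet w) ∧ inGadget w (edgeIndex j b) ⟧)

    cutG-bound : cutG + cutG ≤ externalCut + misplaced
    cutG-bound = begin
        cutG + cutG
      ≤⟨ cutG-twice ⟩
        ∑slots cutPair + ∑slots misplacedNear + ∑slots misplacedFar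
      ≡⟨ +-assoc (∑slots cutPair) _ _ ⟩
        ∑slots cutPair + (∑slots misplacedNear + ∑slots misplacedFar)
      ≤⟨ +-mono-≤ cutPairs≤externalCut (+-mono-≤ (≤-reflexive misplacedNear≡) misplacedFar≤) ⟩
        externalCut + (∑[ v < n ] (⟦ majoritySet v ⟧ * edgesOutside (inGadget v))
                      + ∑[ v < n ] (⟦ not (majoritySet v) ⟧ * edgesInside (inGadget v)))
      ≡⟨ cong (externalCut +_) (sym (∑-distrib-+ (λ v → ⟦ majoritySet v ⟧ * edgesOutside (inGadget v))
                                                 (λ v → ⟦ not (majoritySet v) ⟧ * edgesInside (inGadget v)))) ⟩
        externalCut + misplaced
      ∎
      where open ≤-Reasoning

    gadgets-cut : 5 * misplaced + 3 * deviations ≤ 54 * internalCuts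
    gadgets-cut = begin
        5 * misplaced + 3 * deviations
      ≡⟨ cong₂ _+_ (*-distribˡ-sum 5 (λ v → misplacedEdges (inGadget v))) (*-distribˡ-sum 3 (λ v → deviation (inGadget v))) ⟩
        ∑[ v < n ] (5 * misplacedEdges (inGadget v)) + ∑[ v < n ] (3 * deviation (inGadget v))
      ≤⟨ ∑-+-≤ n (λ v → 5 * misplacedEdges (inGadget v)) (λ v → 3 * deviation (inGadget v)) (λ v → gadget-cut (inGadget v)) ⟩
        ∑[ v < n ] (54 * internalCut (inGadget v))
      ≡⟨ sym (*-distribˡ-sum 54 (λ v → internalCut (inGadget v))) ⟩
        54 * internalCuts
      ∎
      where open ≤-Reasoning

    ∑-side : ∀ (side : Fin n → Fin 10 → Bool) (a : Fin n → Bool) →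
             (∀ v → ∑[ k < 10 ] ⟦ side v k ⟧ ≤ 10 * ⟦ a v ⟧ + deviation (inGadget v)) →
             ∑[ v < n ] ∑[ k < 10 ] ⟦ side v k ⟧ ≤ 10 * ∑[ v < n ] ⟦ a v ⟧ + deviations
    ∑-side side a local = begin
        ∑[ v < n ] ∑[ k < 10 ] ⟦ side v k ⟧
      ≤⟨ ∑-mono n local ⟩
        ∑[ v < n ] (10 * ⟦ a v ⟧ + deviation (inGadget v))
      ≡⟨ ∑-distrib-+ (λ v → 10 * ⟦ a v ⟧) (λ v → deviation (inGadget v)) ⟩
        ∑[ v < n ] (10 * ⟦ a v ⟧) + deviations
      ≡⟨ cong (_+ deviations) (sym (*-distribˡ-sum 10 (λ v → ⟦ a v ⟧))) ⟩
        10 * ∑[ v < n ] ⟦ a v ⟧ + deviations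
      ∎
      where open ≤-Reasoning

    minSide-bound : minSide S ≤ 10 * minSide (tabulate majoritySet) + deviations
    minSide-bound = begin
        size S ⊓ (n * 10 ∸ size S)
      ≡⟨ cong₂ _⊓_ sizeS (trans (cong (n * 10 ∸_) (size-∑ S)) (trans (∑-complement (n * 10) (lookup S))
                                                                      (∑-combine n 10 (λ x → ⟦ not (lookup S x) ⟧)))) ⟩
        ∑[ v < n ] inside (inGadget v) ⊓ ∑[ v < n ] outside (inGadget v)
      ≤⟨ ⊓-mono-≤ (∑-side inGadget majoritySet (λ v → gadget-inside (inGadget v)))
                  (∑-side (λ v k → not (inGadget v k)) (λ v → not (majoritySet v)) (λ v → gadget-outside (inGadget v))) ⟩
        (10 * ∑[ v < n ] ⟦ majoritySet v ⟧ + deviations) ⊓ (10 * ∑[ v < n ] ⟦ not (majoritySet v) ⟧ + deviations)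
      ≡⟨ sym (+-distribʳ-⊓ deviations (10 * insideA) (10 * outsideA)) ⟩
        (10 * ∑[ v < n ] ⟦ majoritySet v ⟧) ⊓ (10 * ∑[ v < n ] ⟦ not (majoritySet v) ⟧) + deviations
      ≡⟨ cong (_+ deviations) (sym (*-distribˡ-⊓ 10 insideA outsideA)) ⟩
        10 * (∑[ v < n ] ⟦ majoritySet v ⟧ ⊓ ∑[ v < n ] ⟦ not (majoritySet v) ⟧) + deviations
      ≡⟨ cong (λ m → 10 * m + deviations) (sym (cong₂ _⊓_ sizeA (trans (cong (n ∸_) sizeA) (∑-complement n majoritySet)))) ⟩
        10 * minSide (tabulate majoritySet) + deviations
      ∎
      where
      open ≤-Reasoning
      sizeS : size S ≡ ∑[ v < n ] inside (inGadget v)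
      sizeS = trans (size-∑ S) (∑-combine n 10 (λ x → ⟦ lookup S x ⟧))
      insideA outsideA : ℕ
      insideA  = ∑[ v < n ] ⟦ majoritySet v ⟧
      outsideA = ∑[ v < n ] ⟦ not (majoritySet v) ⟧
      sizeA : size (tabulate majoritySet) ≡ ∑[ v < n ] ⟦ majoritySet v ⟧
      sizeA = size-tabulate majoritySet

    cut-bound : 10 * cutG + 3 * deviations ≤ 54 * cut (adjX nb f) S
    cut-bound = chain-bounds {cutG} {externalCut} {misplaced} {deviations} {internalCuts} cutG-bound gadgets-cut internal+external≤cutX


module RationalStep where

  open import Data.Nat using (zero; suc; _+_; _*_; _≤_; z≤n)
  open import Data.Nat.Properties using (*-monoʳ-≤; *-monoˡ-≤; +-mono-≤; ≤-trans; *-zeroʳ; module ≤-Reasoning)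
  open import Data.Integer as ℤ using (ℤ; +_; -[1+_]; +≤+; -≤+)
  import Data.Integer.Properties as ℤ
  open import Data.Rational using (ℚ; mkℚ; toℚᵘ) renaming (_≤_ to _≤ℚ_; _*_ to _*ℚ_; _/_ to _/ℚ_)
  import Data.Rational.Properties as ℚ
  open import Data.Rational.Unnormalised using (mkℚᵘ; *≤*) renaming (_≤_ to _≤ᵘ_; _*_ to _*ᵘ_; _≃_ to _≃ᵘ_)
  import Data.Rational.Unnormalised.Properties as ℚᵘ
  open import Relation.Binary.PropositionalEquality
  open import Data.Nat.Tactic.RingSolver using (solve-∀)

  cross-multiplied : ∀ p q c₁ c C D m s → p * 1 ≤ c₁ * q → c₁ ≤ 3 → p * m ≤ c * q →
                     s ≤ 10 * m + D → 10 * c + 3 * D ≤ 54 * C → p * s ≤ C * (54 * q)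
  cross-multiplied p q c₁ c C D m s p≤c₁ c₁≤3 pm≤c s≤ bound = begin
      p * s
    ≤⟨ *-monoʳ-≤ p s≤ ⟩
      p * (10 * m + D)
    ≡⟨ expand p m D ⟩
      10 * (p * m) + (p * 1) * D
    ≤⟨ +-mono-≤ (*-monoʳ-≤ 10 pm≤c) (*-monoˡ-≤ D (≤-trans p≤c₁ (*-monoˡ-≤ q c₁≤3))) ⟩
      10 * (c * q) + (3 * q) * D
    ≡⟨ collect c q D ⟩
      (10 * c + 3 * D) * q
    ≤⟨ *-monoˡ-≤ q bound ⟩
      (54 * C) * q
    ≡⟨ reassociate C q ⟩
      C * (54 * q)
    ∎
    where
    open ≤-Reasoning
    expand : ∀ a b d → a * (10 * b + d) ≡ 10 * (a * b) + (a * 1) * d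
    expand = solve-∀
    collect : ∀ a b d → 10 * (a * b) + (3 * b) * d ≡ (10 * a + 3 * d) * b
    collect = solve-∀
    reassociate : ∀ a b → (54 * a) * b ≡ a * (54 * b)
    reassociate = solve-∀

  ℕ→ℤ-≤ : ∀ a b c d → a * b ≤ c * d → + a ℤ.* + b ℤ.≤ + c ℤ.* + d
  ℕ→ℤ-≤ a b c d h rewrite sym (ℤ.pos-* a b) | sym (ℤ.pos-* c d) = +≤+ h

  ℤ→ℕ-≤ : ∀ a b c d → + a ℤ.* + b ℤ.≤ + c ℤ.* + d → a * b ≤ c * d
  ℤ→ℕ-≤ a b c d h rewrite sym (ℤ.pos-* a b) | sym (ℤ.pos-* c d) = ℤ.drop‿+≤+ h

  /≃mkℚᵘ : ∀ (i : ℤ) b → toℚᵘ (i /ℚ suc b) ≃ᵘ mkℚᵘ i b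
  /≃mkℚᵘ i b = ℚ.toℚᵘ-fromℚᵘ (mkℚᵘ i b)

  rational-bound : ∀ (r : ℚ) c₁ c C D m s → r ≤ℚ (+ c₁) /ℚ 1 → c₁ ≤ 3 →
                   (∀ m' → m ≡ suc m' → r ≤ℚ (+ c) /ℚ suc m') →
                   suc s ≤ 10 * m + D → 10 * c + 3 * D ≤ 54 * C →
                   ((+ 1) /ℚ 54) *ℚ r ≤ℚ (+ C) /ℚ suc s
  rational-bound r@(mkℚ p q-1 _) c₁ c C D m s r≤c₁ c₁≤3 r≤c/m s≤ bound =
    ℚ.toℚᵘ-cancel-≤ (ℚᵘ.≤-respʳ-≃ (ℚᵘ.≃-sym (/≃mkℚᵘ (+ C) s))
      (ℚᵘ.≤-respˡ-≃ (ℚᵘ.≃-sym (ℚᵘ.≃-trans (ℚ.toℚᵘ-homo-* ((+ 1) /ℚ 54) r) (ℚᵘ.*-cong (/≃mkℚᵘ (+ 1) 53) ℚᵘ.≃-refl)))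
        (unnormalised p (raw 0 r≤c₁) (λ m' e → raw m' (r≤c/m m' e)))))
    where
    raw : ∀ {i} d → r ≤ℚ (+ i) /ℚ suc d → mkℚᵘ p q-1 ≤ᵘ mkℚᵘ (+ i) d
    raw d le = ℚᵘ.≤-respʳ-≃ (/≃mkℚᵘ _ d) (ℚ.toℚᵘ-mono-≤ le)
    -- The estimate on raw fractions: trivial for a negative numerator, cross-multiplied otherwise.
    unnormalised : ∀ num → mkℚᵘ num q-1 ≤ᵘ mkℚᵘ (+ c₁) 0 → (∀ m' → m ≡ suc m' → mkℚᵘ num q-1 ≤ᵘ mkℚᵘ (+ c) m') →
                   mkℚᵘ (+ 1) 53 *ᵘ mkℚᵘ num q-1 ≤ᵘ mkℚᵘ (+ C) s
    unnormalised -[1+ a ] _ _ = *≤* (negative≤ (a + 0) _)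
      where
      negative≤ : ∀ x k → -[1+ x ] ℤ.* + suc s ℤ.≤ + C ℤ.* + k
      negative≤ x k rewrite sym (ℤ.pos-* C k) = -≤+
    unnormalised (+ a) (*≤* a≤c₁) r≤c/m′ rewrite ℤ.*-identityˡ (+ a) =
      *≤* (ℕ→ℤ-≤ a (suc s) C (54 * suc q-1)
            (cross-multiplied a (suc q-1) c₁ c C D m (suc s) (ℤ→ℕ-≤ a 1 c₁ (suc q-1) a≤c₁) c₁≤3 (am≤c m r≤c/m′) s≤ bound))
      where
      am≤c : ∀ m → (∀ m' → m ≡ suc m' → mkℚᵘ (+ a) q-1 ≤ᵘ mkℚᵘ (+ c) m') → a * m ≤ c * suc q-1
      am≤c zero     _ rewrite *-zeroʳ a = z≤n
      am≤c (suc m') h with h m' refl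
      ... | *≤* le = ℤ→ℕ-≤ a (suc m') c (suc q-1) le


module MainBound where

  open import Data.Bool using (Bool; true)
  open import Data.Nat as ℕ using (ℕ; zero; suc)
  open import Data.Fin using (Fin; zero)
  open import Data.Vec using (tabulate)
  open import Data.Integer using (+_)
  open import Data.Rational using (_/_; _*_; _≤_)
  import Data.Rational.Properties as ℚ
  open import Data.Product using (∃; _,_)
  open import Data.Empty using (⊥-elim)
  open import Relation.Binary.PropositionalEquality
  open import Defs
  open Expansion
  open CubicGraph
  open CutCounting
  open RationalStep

  -- Ex(S) ≥ Ex(G)/54 for every nonempty proper subset S of the vertices of X_f(G), provided G has
  -- at least two vertices. (The case split on the smaller side of S goes through a helper rather
  -- than `with`, which would make Agda normalise Ex(S).)
  subset-bound : ∀ {k} {nb : Fin (suc (suc k)) → Fin 3 → Fin (suc (suc k))} (cubic : Cubic (suc (suc k)) nb) f S →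
                 isNonemptyProper S ≡ true → ((+ 1) / 54) * Ex (adjG nb) ≤ ExS (adjX nb f) S
  subset-bound {k} {nb} cubic f S nonemptyProper = fromMinSide (nonemptyProper⇒minSide S nonemptyProper)
    where
    A : Subset (suc (suc k))
    A = tabulate (majoritySet cubic f S)
    Ex≤cutG/m : ∀ m → minSide A ≡ suc m → Ex (adjG nb) ≤ (+ cutG cubic f S) / suc m
    Ex≤cutG/m m eq = subst (Ex (adjG nb) ≤_) (ExS-fraction (adjG nb) A m eq) (Ex-≤ (adjG nb) A (minSide⇒nonemptyProper A m eq))
    fromMinSide : (∃ λ s → minSide S ≡ suc s) → ((+ 1) / 54) * Ex (adjG nb) ≤ ExS (adjX nb f) S
    fromMinSide (s , minSide≡) = subst (((+ 1) / 54) * Ex (adjG nb) ≤_) (sym (ExS-fraction (adjX nb f) S s minSide≡))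
      (rational-bound (Ex (adjG nb)) (cut (adjG nb) (singleton zero)) (cutG cubic f S) (cut (adjX nb f) S)
                      (deviations cubic f S) (minSide A) s
                      (Ex-≤-singleton (adjG nb) zero) (cut-singleton nb zero) Ex≤cutG/m
                      (subst (λ x → x ℕ.≤ 10 ℕ.* minSide A ℕ.+ deviations cubic f S) minSide≡ (minSide-bound cubic f S))
                      (cut-bound cubic f S))

  -- With no vertices both
  -- expansions are 0; a single vertex cannot carry a loopless cubic graph; otherwise Ex(X_f(G)) is
  -- the minimum of the Ex(S) bounded by subset-bound.
  expansion-bound : ∀ n (nb : Fin n → Fin 3 → Fin n) → Cubic n nb → (f : Fin n → Fin n → Bool) →
                    ((+ 1) / 54) * Ex (adjG nb) ≤ Ex (adjX nb f)
  expansion-bound zero                nb cubic f = ℚ.≤-reflexive (ℚ.*-zeroʳ ((+ 1) / 54))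
  expansion-bound (suc zero)          nb cubic f = ⊥-elim (Cubic.loopless cubic zero zero (onlyVertex (nb zero zero)))
    where
    onlyVertex : ∀ (x : Fin 1) → x ≡ zero
    onlyVertex zero = refl
  expansion-bound (suc (suc k))       nb cubic f =
    Ex-glb (adjX nb f) (singleton zero) (singleton-nonemptyProper {8 ℕ.+ suc k ℕ.* 10} zero) (subset-bound cubic f)


open import Defs
open import Data.Bool using (Bool)
open import Data.Nat using (ℕ)
open import Data.Fin using (Fin)
open import Data.Integer using (+_)
open import Data.Rational using (_≤_; _<_; _*_; _/_)
open import Data.Product using (_×_; _,_)
open import Relation.Binary.PropositionalEquality using (_≡_)
open import Function.Definitions using (Injective)
open MainBound using (expansion-bound)

lemma3 : (n : ℕ) (nb : Fin n → Fin 3 → Fin n) → Cubic n nb →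
         (c : Fin n → ℕ) → Injective _≡_ _≡_ c →
         (f : Fin n → Fin n → Bool) → (∀ u v → f u v ≡ f v u) →
         (EvenParity nb f → ((+ 1) / 54) * Ex (adjG nb) ≤ Ex (adjX nb f))
         × (OddParity nb f → (987 ÷ℕ n) < Ex (adjG nb) →
            ((+ 1) / 54) * Ex (adjG nb) ≤ Ex (adjX nb f))
lemma3 n nb cubic _ _ f _ = (λ _ → expansion-bound n nb cubic f) , (λ _ _ → expansion-bound n nb cubic f)
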